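{- (1) $\mathit{true}_r$ and $\mathit{false}$ are $\mathbf{CDC}$-healthy, and if $P$ and $Q$ are $\mathbf{CDC}$-healthy then so are $P\vee Q$ and $P\wedge Q$. (2) If $Q$ is $\mathbf{CDC}$-healthy then $P;Q$ is $\mathbf{CDC}$-healthy for every relation $P$. (3) If $P(i)$ is $\mathbf{CDC}$-healthy for every $i\in I$, then $\bigwedge_{i\in I}P(i)$ and $\bigvee_{i\in I}P(i)$ are $\mathbf{CDC}$-healthy. (4) For every state predicate $s$, trace expression $t$ and event-set expression $E$, $\mathcal{E}(s,t,E)$ is $\mathbf{CDC}$-healthy.
   Context: UTP setting: relations are predicates over undashed (initial) and dashed (final) variables; $;$ is relational composition; $P\lhd c\rhd Q = (c\wedge P)\vee(\neg c\wedge Q)$. Observational variables: booleans $ok,ok',wait,wait'$; traces $tr,tr'$ (finite event sequences; $\le$ prefix; $-$ removal of a prefix); state $st,st'$; refusal sets $ref,ref'$; $tt$ abbreviates $tr'-tr$. $\mathbf{R1}(P) = P\wedge tr\le tr'$; $\mathbf{R2}(P) = P[\langle\rangle,tr'-tr/tr,tr']\lhd tr\le tr'\rhd P$; $\mathbf{RR}(P)=\exists ok,ok',wait,wait'\bullet\mathbf{R1}(\mathbf{R2}(P))$; $\mathbf{CRR}(P) = \exists ref\bullet\mathbf{RR}(P)$; $\mathit{true}_r = \mathbf{R1}(\mathit{true})$. $\mathcal{E}(s,t,A) = \mathbf{CRR}(s\wedge tt=t\wedge\forall e\in A\bullet e\notin ref')$ for a state predicate $s$, trace-valued expression $t$ and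 event-set-valued expression $A$ over $st$. Refusal downward closure: $\mathbf{CDC}(P) = \exists ref_0\bullet P[ref_0/ref']\wedge ref'\subseteq ref_0$; $P$ is $\mathbf{CDC}$-healthy iff $\mathbf{CDC}(P) = P$. -}

module Defs where

open import Level using (0ℓ; Lift) renaming (suc to lsuc)
open import Data.Bool using (Bool)
open import Data.List using (List; []; length; drop)
open import Data.List.Relation.Binary.Prefix.Heterogeneous using (Prefix)
open import Data.Product using (Σ; _×_; _,_)
open import Data.Sum using (_⊎_)
open import Data.Empty.Polymorphic using (⊥)
open import Data.Unit.Polymorphic using (⊤)
open import Relation.Nullary using (¬_)
open import Relation.Unary using (Pred; _⊆_)
open import Relation.Binary.PropositionalEquality using (_≡_)
open import Function.Bundles using (_⇔_)

module UTP (Event State : Set) where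

  Refusal : Set₁
  Refusal = Pred Event 0ℓ

  record Obs : Set₁ where
    constructor obs
    field
      ok   : Bool
      wait : Bool
      tr   : List Event
      st   : State
      ref  : Refusal
  open Obs public

  -- A relation: a predicate over initial (undashed) and final (dashed) observations.
  Rel : Set₂
  Rel = Obs → Obs → Set₁

  _≐_ : Rel → Rel → Set₁
  P ≐ Q = ∀ v v' → P v v' ⇔ Q v v'

  setOk : Obs → Bool → Obs
  setOk (obs _ w t s r) b = obs b w t s r
  setWait : Obs → Bool → Obs
  setWait (obs o _ t s r) b = obs o b t s r
  setTr : Obs → List Event → Obs
  setTr (obs o w _ s r) t = obs o w t s r
  setRef : Obs → Refusal → Obs
  setRef (obs o w t s _) r = obs o w t s r

  _≤ₜ_ : List Event → List Event → Set
  _≤ₜ_ = Prefix _≡_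

  -- Prefix removal  tr' - tr  (agrees with the partial operation when tr ≤ tr')
  _-ₜ_ : List Event → List Event → List Event
  t' -ₜ t = drop (length t) t'

  tt : Obs → Obs → List Event
  tt v v' = tr v' -ₜ tr v

  _∨ᵣ_ : Rel → Rel → Rel
  (P ∨ᵣ Q) v v' = P v v' ⊎ Q v v'
  _∧ᵣ_ : Rel → Rel → Rel
  (P ∧ᵣ Q) v v' = P v v' × Q v v'
  trueᵣ-pred falseᵣ : Rel
  trueᵣ-pred v v' = ⊤
  falseᵣ v v' = ⊥
  ⋀ : {I : Set} → (I → Rel) → Rel
  ⋀ {I} P v v' = (i : I) → P i v v'
  ⋁ : {I : Set} → (I → Rel) → Rel
  ⋁ {I} P v v' = Σ I (λ i → P i v v')

  _⨾_ : Rel → Rel → Rel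
  (P ⨾ Q) v v' = Σ Obs (λ v₀ → P v v₀ × Q v₀ v')

  R1 : Rel → Rel
  R1 P v v' = P v v' × (tr v ≤ₜ tr v')

  -- R2(P) = P[⟨⟩, tr'-tr / tr, tr'] ◁ tr ≤ tr' ▷ P
  R2 : Rel → Rel
  R2 P v v' =
    ((tr v ≤ₜ tr v') × P (setTr v []) (setTr v' (tr v' -ₜ tr v)))
    ⊎ (¬ (tr v ≤ₜ tr v') × P v v')

  RR : Rel → Rel
  RR P v v' = Σ Bool λ o → Σ Bool λ o' → Σ Bool λ w → Σ Bool λ w' →
    R1 (R2 P) (setWait (setOk v o) w) (setWait (setOk v' o') w')

  CRR : Rel → Rel
  CRR P v v' = Σ Refusal λ r → RR P (setRef v r) v'

  trueᵣ : Rel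
  trueᵣ = R1 trueᵣ-pred

  𝓔 : (State → Set) → (State → List Event) → (State → Refusal) → Rel
  𝓔 s t A = CRR (λ v v' →
    Lift (lsuc 0ℓ) (s (st v) × (tt v v' ≡ t (st v))
      × (∀ e → A (st v) e → ¬ (ref v' e))))

  CDC : Rel → Rel
  CDC P v v' = Σ Refusal λ r₀ → P v (setRef v' r₀) × (ref v' ⊆ r₀)

  CDC-healthy : Rel → Set₁
  CDC-healthy P = CDC P ≐ P

-- CDC P always contains P (take ref₀ = ref'), so CDC-healthiness says exactly that
-- P is closed under shrinking the final refusal set. Every connective preserves
-- this closure in its arguments, relational composition needs it only of the
-- second relation (which alone constrains ref'), and 𝓔 mentions ref' only in
-- the negative position e ∉ ref'.
module Submission where

open import Defs
open import Data.Product using (_×_; _,_)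
open import Data.Sum using (inj₁; inj₂)
open import Data.List using (List)
open import Relation.Nullary using (¬_)
open import Relation.Unary using (Pred; _⊆_)
open import Level using (0ℓ; lift)
open import Function.Bundles using (mk⇔; Equivalence)

module CDC-Properties (Event State : Set) where
  open UTP Event State

  RefDownwardClosed : Rel → Set₁
  RefDownwardClosed P = ∀ v v' r₀ → P v (setRef v' r₀) → ref v' ⊆ r₀ → P v v'

  downwardClosed⇒CDC-healthy : ∀ P → RefDownwardClosed P → CDC-healthy P
  downwardClosed⇒CDC-healthy P closed v v' =
    mk⇔ (λ (r₀ , p , ref'⊆r₀) → closed v v' r₀ p ref'⊆r₀)
        (λ p → ref v' , p , λ {_} e∈ref' → e∈ref')

  CDC-healthy⇒downwardClosed : ∀ P → CDC-healthy P → RefDownwardClosed P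
  CDC-healthy⇒downwardClosed P healthy v v' r₀ p ref'⊆r₀ =
    Equivalence.to (healthy v v') (r₀ , p , ref'⊆r₀)

  trueᵣ-CDC-healthy : CDC-healthy trueᵣ
  trueᵣ-CDC-healthy = downwardClosed⇒CDC-healthy trueᵣ λ _ _ _ p _ → p

  falseᵣ-CDC-healthy : CDC-healthy falseᵣ
  falseᵣ-CDC-healthy = downwardClosed⇒CDC-healthy falseᵣ λ _ _ _ ()

  ⋀-CDC-healthy : ∀ (I : Set) (P : I → Rel) → (∀ i → CDC-healthy (P i)) → CDC-healthy (⋀ P)
  ⋀-CDC-healthy I P healthy = downwardClosed⇒CDC-healthy (⋀ P) λ v v' r₀ p ref'⊆r₀ i →
    CDC-healthy⇒downwardClosed (P i) (healthy i) v v' r₀ (p i) ref'⊆r₀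

  ⋁-CDC-healthy : ∀ (I : Set) (P : I → Rel) → (∀ i → CDC-healthy (P i)) → CDC-healthy (⋁ P)
  ⋁-CDC-healthy I P healthy = downwardClosed⇒CDC-healthy (⋁ P) λ v v' r₀ (i , p) ref'⊆r₀ →
    i , CDC-healthy⇒downwardClosed (P i) (healthy i) v v' r₀ p ref'⊆r₀

  ∨ᵣ-CDC-healthy : ∀ P Q → CDC-healthy P → CDC-healthy Q → CDC-healthy (P ∨ᵣ Q)
  ∨ᵣ-CDC-healthy P Q healthyP healthyQ = downwardClosed⇒CDC-healthy (P ∨ᵣ Q) λ where
    v v' r₀ (inj₁ p) ref'⊆r₀ → inj₁ (CDC-healthy⇒downwardClosed P healthyP v v' r₀ p ref'⊆r₀)
    v v' r₀ (inj₂ q) ref'⊆r₀ → inj₂ (CDC-healthy⇒downwardClosed Q healthyQ v v' r₀ q ref'⊆r₀)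

  ∧ᵣ-CDC-healthy : ∀ P Q → CDC-healthy P → CDC-healthy Q → CDC-healthy (P ∧ᵣ Q)
  ∧ᵣ-CDC-healthy P Q healthyP healthyQ = downwardClosed⇒CDC-healthy (P ∧ᵣ Q) λ v v' r₀ (p , q) ref'⊆r₀ →
      CDC-healthy⇒downwardClosed P healthyP v v' r₀ p ref'⊆r₀
    , CDC-healthy⇒downwardClosed Q healthyQ v v' r₀ q ref'⊆r₀

  ⨾-CDC-healthy : ∀ P Q → CDC-healthy Q → CDC-healthy (P ⨾ Q)
  ⨾-CDC-healthy P Q healthyQ = downwardClosed⇒CDC-healthy (P ⨾ Q) λ v v' r₀ (v₀ , p , q) ref'⊆r₀ →
    v₀ , p , CDC-healthy⇒downwardClosed Q healthyQ v₀ v' r₀ q ref'⊆r₀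

  disjoint-⊆ : ∀ {A r r₀ : Pred Event 0ℓ} → (∀ e → A e → ¬ r₀ e) → r ⊆ r₀ → ∀ e → A e → ¬ r e
  disjoint-⊆ A∩r₀≡∅ r⊆r₀ e e∈A e∈r = A∩r₀≡∅ e e∈A (r⊆r₀ e∈r)

  𝓔-CDC-healthy : ∀ (s : State → Set) (t : State → List Event) (E : State → Pred Event 0ℓ)
                  → CDC-healthy (𝓔 s t E)
  𝓔-CDC-healthy s t E = downwardClosed⇒CDC-healthy (𝓔 s t E) λ where
    v v' r₀ (r , o , o' , w , w' , inj₁ (tr≤tr' , lift (sv , tt≡t , E∩r₀≡∅)) , prefix) ref'⊆r₀ →
      r , o , o' , w , w' , inj₁ (tr≤tr' , lift (sv , tt≡t , disjoint-⊆ E∩r₀≡∅ ref'⊆r₀)) , prefix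
    v v' r₀ (r , o , o' , w , w' , inj₂ (tr≰tr' , lift (sv , tt≡t , E∩r₀≡∅)) , prefix) ref'⊆r₀ →
      r , o , o' , w , w' , inj₂ (tr≰tr' , lift (sv , tt≡t , disjoint-⊆ E∩r₀≡∅ ref'⊆r₀)) , prefix

theorem44 : (Event State : Set) → let open UTP Event State in
    -- (1)
    (CDC-healthy trueᵣ × CDC-healthy falseᵣ
      × (∀ P Q → CDC-healthy P → CDC-healthy Q → CDC-healthy (P ∨ᵣ Q))
      × (∀ P Q → CDC-healthy P → CDC-healthy Q → CDC-healthy (P ∧ᵣ Q)))
    -- (2)
    × (∀ P Q → CDC-healthy Q → CDC-healthy (P ⨾ Q))
    -- (3)
    × (∀ (I : Set) (P : I → Rel) → (∀ i → CDC-healthy (P i))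
        → CDC-healthy (⋀ P) × CDC-healthy (⋁ P))
    -- (4)
    × (∀ (s : State → Set) (t : State → List Event) (E : State → Pred Event 0ℓ)
        → CDC-healthy (𝓔 s t E))
theorem44 Event State =
    (trueᵣ-CDC-healthy , falseᵣ-CDC-healthy , ∨ᵣ-CDC-healthy , ∧ᵣ-CDC-healthy)
  , ⨾-CDC-healthy
  , (λ I P healthy → ⋀-CDC-healthy I P healthy , ⋁-CDC-healthy I P healthy)
  , 𝓔-CDC-healthy
  where open CDC-Properties Event State
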